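{- For every \textsf{SLAH} formula $\varphi$, $\varphi$ is satisfiable (there exist a stack $s$ and heap $h$ with $s,h\models\varphi$) if and only if the quantifier-free Presburger arithmetic formula $\mathtt{Abs}(\varphi)$ is satisfiable over $\mathbb{N}$.
   Context: \textsf{SLAH}: variables $\mathcal{V}$ range over $\mathbb{N}$; terms $t::=x\mid n\mid t+t$; pure formulas $\Pi$ are conjunctions of $\top,\bot,t=t,t\ne t,t\le t,t<t$; spatial formulas $\Sigma$ are $\ast$-conjunctions of atoms $\mathtt{emp}$, $t\mapsto t$, $\mathtt{blk}(t,t)$, $\mathtt{hls}(t,t;t^\infty)$ ($t^\infty$ a term or $\infty$); formulas are $\exists\vec z\cdot\Pi:\Sigma$. Semantics (stack $s:\mathcal{V}\to\mathbb{N}$, heap $h:\mathbb{N}\rightharpoonup\mathbb{N}$): $t_1\mapsto t_2$ holds iff $\mathrm{dom}(h)=\{s(t_1)\}$ and $h(s(t_1))=s(t_2)$; $\mathtt{blk}(t_1,t_2)$ iff $s(t_1)<s(t_2)$ and $\mathrm{dom}(h)=\{s(t_1),\dots,s(t_2)-1\}$; $\mathtt{emp}$ iff $\mathrm{dom}(h)=\emptyset$; $\ast$ splits the heap into disjoint parts; $\mathtt{hls}(t_1,t_2;t^\infty)$ holds iff $\mathtt{hls}^k$ holds for some $k$, where $\mathtt{hls}^0$ means $s(t_1)=s(t_2)$ and empty heap, and $\mathtt{hls}^{\ell+1}(t_1,t_2;t^\infty)$ means $\exists z\cdot 2\le z-t_1\wedge\Pi':t_1\mapsto z-t_1\ast\mathtt{blk}(t_1+1,z)\ast\mathtt{hls}^\ell(z,t_2;t^\infty)$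 with $\Pi'\equiv\top$ if $t^\infty=\infty$ and $\Pi'\equiv z-t_1\le t^\infty$ otherwise; $\exists\vec z$ and $\wedge$, $\Pi:\Sigma$ as usual. Start/end addresses: $\mathrm{head}(t_1\mapsto t_2)=t_1$, $\mathrm{tail}(t_1\mapsto t_2)=t_1+1$; for $a=\mathtt{blk}(t_1,t_2)$ or $a=\mathtt{hls}(t_1,t_2;t_3)$, $\mathrm{head}(a)=t_1$, $\mathrm{tail}(a)=t_2$. Abstraction. For $\varphi\equiv\exists\vec z\cdot\Pi:\Sigma$, $\mathtt{Abs}(\varphi):=\mathtt{Abs}(\Pi:\Sigma):=\Pi\wedge\phi_\Sigma\wedge\phi_\ast$ where, with $a_1,\dots,a_m$ the spatial atoms (other than $\mathtt{emp}$) occurring in $\Sigma$: $\phi_\Sigma=\bigwedge_i\mathtt{Abs}(a_i)$ with $\mathtt{Abs}(t_1\mapsto t_2)=\top$, $\mathtt{Abs}(\mathtt{blk}(t_1,t_2))=t_1<t_2$, $\mathtt{Abs}(\mathtt{hls}(t_1,t_2;t_3))= t_1=t_2\ \vee\ (t_1<t_2\wedge A^+)$, where $A^+=(t_3=2\wedge t_1+2\le t_2\wedge t_1\equiv_2 t_2)\vee(2<t_3\wedge t_1+2\le t_2)$ if $t_3$ is a term and $A^+= t_1+2\le t_2$ if $t_3=\infty$. Writing $D_{ij}:=\mathrm{tail}(a_j)\le\mathrm{head}(a_i)\vee\mathrm{tail}(a_i)\le\mathrm{head}(a_j)$ and $N_i:=\mathrm{head}(a_i)<\mathrm{tail}(a_i)$,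 $\phi_\ast$ is the conjunction over all $i<j$ of: $(N_i\wedge N_j)\to D_{ij}$ if both $a_i,a_j$ are $\mathtt{hls}$ atoms; $N_k\to D_{ij}$ if exactly one of them, $a_k$, is an $\mathtt{hls}$ atom; and $D_{ij}$ if neither is an $\mathtt{hls}$ atom. -}

module Defs where

open import Data.Nat using (ℕ; _+_; _∸_; _≤_; _<_; _%_; _≟_)
open import Data.Maybe using (Maybe; just; nothing)
open import Data.List using (List; []; _∷_)
open import Data.Product using (Σ; ∃; _×_; _,_)
open import Data.Sum using (_⊎_)
open import Data.Unit using (⊤)
open import Data.Empty using (⊥)
open import Relation.Nullary using (¬_; yes; no)
open import Relation.Binary.PropositionalEquality using (_≡_; _≢_)

Var : Set
Var = ℕ

data Term : Set where
  var  : Var → Term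
  num  : ℕ → Term
  _⊕_  : Term → Term → Term

data PureAtom : Set where
  ptop pbot : PureAtom
  _=ₚ_ _≠ₚ_ _≤ₚ_ _<ₚ_ : Term → Term → PureAtom

Pure : Set
Pure = List PureAtom

-- t^∞ : a term (just t) or ∞ (nothing)
TermInf : Set
TermInf = Maybe Term

data SpAtom : Set where
  emp : SpAtom
  _↦_ : Term → Term → SpAtom
  blk : Term → Term → SpAtom
  hls : Term → Term → TermInf → SpAtom

Spatial : Set
Spatial = List SpAtom

record Formula : Set where
  constructor ∃[_]·_∶_
  field
    bound   : List Var
    pure    : Pure
    spatial : Spatial

Stack : Set
Stack = Var → ℕ

Heap : Set
Heap = ℕ → Maybe ℕ

⟦_⟧ : Term → Stack → ℕ
⟦ var x ⟧ s = s x
⟦ num n ⟧ s = n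
⟦ t ⊕ u ⟧ s = ⟦ t ⟧ s + ⟦ u ⟧ s

InDom : Heap → ℕ → Set
InDom h a = ∃ λ v → h a ≡ just v

DomIs : Heap → (ℕ → Set) → Set
DomIs h P = ∀ a → (InDom h a → P a) × (P a → InDom h a)

Split : Heap → Heap → Heap → Set
Split h h₁ h₂ = ∀ a → (h₁ a ≡ nothing × h a ≡ h₂ a) ⊎ (h₂ a ≡ nothing × h a ≡ h₁ a)

EmpH : Heap → Set
EmpH h = DomIs h (λ _ → ⊥)

PtoH : ℕ → ℕ → Heap → Set
PtoH a b h = DomIs h (λ x → x ≡ a) × h a ≡ just b

BlkH : ℕ → ℕ → Heap → Set
BlkH a b h = a < b × DomIs h (λ x → a ≤ x × x < b)

boundOK : ℕ → Maybe ℕ → Set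
boundOK d nothing  = ⊤
boundOK d (just m) = d ≤ m

HlsK : ℕ → ℕ → ℕ → Maybe ℕ → Heap → Set
HlsK ℕ.zero    a b m h = a ≡ b × EmpH h
HlsK (ℕ.suc l) a b m h =
  Σ ℕ λ z → 2 ≤ z ∸ a × boundOK (z ∸ a) m ×
  Σ Heap λ h₁ → Σ Heap λ h' → Split h h₁ h' × PtoH a (z ∸ a) h₁ ×
  Σ Heap λ h₂ → Σ Heap λ h₃ → Split h' h₂ h₃ × BlkH (a + 1) z h₂ ×
  HlsK l z b m h₃

evalInf : TermInf → Stack → Maybe ℕ
evalInf nothing  s = nothing
evalInf (just t) s = just (⟦ t ⟧ s)

_,_⊨ₐ_ : Stack → Heap → SpAtom → Set
s , h ⊨ₐ emp = EmpH h
s , h ⊨ₐ (t ↦ u) = PtoH (⟦ t ⟧ s) (⟦ u ⟧ s) h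
s , h ⊨ₐ blk t u = BlkH (⟦ t ⟧ s) (⟦ u ⟧ s) h
s , h ⊨ₐ hls t u m = ∃ λ k → HlsK k (⟦ t ⟧ s) (⟦ u ⟧ s) (evalInf m s) h

_,_⊨ₛ_ : Stack → Heap → Spatial → Set
s , h ⊨ₛ [] = EmpH h
s , h ⊨ₛ (a ∷ Σ') = Σ Heap λ h₁ → Σ Heap λ h₂ → Split h h₁ h₂ × (s , h₁ ⊨ₐ a) × (s , h₂ ⊨ₛ Σ')

_⊨ₚₐ_ : Stack → PureAtom → Set
s ⊨ₚₐ ptop = ⊤
s ⊨ₚₐ pbot = ⊥
s ⊨ₚₐ (t =ₚ u) = ⟦ t ⟧ s ≡ ⟦ u ⟧ s
s ⊨ₚₐ (t ≠ₚ u) = ⟦ t ⟧ s ≢ ⟦ u ⟧ s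
s ⊨ₚₐ (t ≤ₚ u) = ⟦ t ⟧ s ≤ ⟦ u ⟧ s
s ⊨ₚₐ (t <ₚ u) = ⟦ t ⟧ s < ⟦ u ⟧ s

_⊨ₚ_ : Stack → Pure → Set
s ⊨ₚ [] = ⊤
s ⊨ₚ (a ∷ Π) = (s ⊨ₚₐ a) × (s ⊨ₚ Π)

update : Stack → Var → ℕ → Stack
update s x v y with y ≟ x
... | yes _ = v
... | no  _ = s y

Models : Stack → Heap → List Var → Pure → Spatial → Set
Models s h [] Π Σ' = (s ⊨ₚ Π) × (s , h ⊨ₛ Σ')
Models s h (z ∷ zs) Π Σ' = ∃ λ v → Models (update s z v) h zs Π Σ'

_,_⊨_ : Stack → Heap → Formula → Set
s , h ⊨ φ = Models s h (Formula.bound φ) (Formula.pure φ) (Formula.spatial φ)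

Satisfiable : Formula → Set
Satisfiable φ = Σ Stack λ s → Σ Heap λ h → s , h ⊨ φ

data QF : Set where
  qtrue qfalse : QF
  _=q_ _≠q_ _≤q_ _<q_ _≡₂_ : Term → Term → QF
  _∧q_ _∨q_ _⇒q_ : QF → QF → QF

_⊨q_ : Stack → QF → Set
s ⊨q qtrue = ⊤
s ⊨q qfalse = ⊥
s ⊨q (t =q u) = ⟦ t ⟧ s ≡ ⟦ u ⟧ s
s ⊨q (t ≠q u) = ⟦ t ⟧ s ≢ ⟦ u ⟧ s
s ⊨q (t ≤q u) = ⟦ t ⟧ s ≤ ⟦ u ⟧ s
s ⊨q (t <q u) = ⟦ t ⟧ s < ⟦ u ⟧ s
s ⊨q (t ≡₂ u) = ⟦ t ⟧ s % 2 ≡ ⟦ u ⟧ s % 2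
s ⊨q (P ∧q Q) = (s ⊨q P) × (s ⊨q Q)
s ⊨q (P ∨q Q) = (s ⊨q P) ⊎ (s ⊨q Q)
s ⊨q (P ⇒q Q) = (s ⊨q P) → (s ⊨q Q)

QFSatisfiable : QF → Set
QFSatisfiable P = Σ Stack λ s → s ⊨q P

pureAtomQF : PureAtom → QF
pureAtomQF ptop = qtrue
pureAtomQF pbot = qfalse
pureAtomQF (t =ₚ u) = t =q u
pureAtomQF (t ≠ₚ u) = t ≠q u
pureAtomQF (t ≤ₚ u) = t ≤q u
pureAtomQF (t <ₚ u) = t <q u

pureQF : Pure → QF
pureQF [] = qtrue
pureQF (a ∷ Π) = pureAtomQF a ∧q pureQF Π

Aplus : Term → Term → TermInf → QF
Aplus t₁ t₂ nothing   = (t₁ ⊕ num 2) ≤q t₂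
Aplus t₁ t₂ (just t₃) =
  ((t₃ =q num 2) ∧q (((t₁ ⊕ num 2) ≤q t₂) ∧q (t₁ ≡₂ t₂)))
  ∨q ((num 2 <q t₃) ∧q ((t₁ ⊕ num 2) ≤q t₂))

absAtom : SpAtom → QF
absAtom emp = qtrue
absAtom (t ↦ u) = qtrue
absAtom (blk t u) = t <q u
absAtom (hls t₁ t₂ t₃) = (t₁ =q t₂) ∨q ((t₁ <q t₂) ∧q Aplus t₁ t₂ t₃)

atoms : Spatial → List SpAtom
atoms [] = []
atoms (emp ∷ Σ') = atoms Σ'
atoms (a ∷ Σ') = a ∷ atoms Σ'

headT : SpAtom → Term
headT emp = num 0
headT (t ↦ u) = t
headT (blk t u) = t
headT (hls t u m) = t

tailT : SpAtom → Term
tailT emp = num 0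
tailT (t ↦ u) = t ⊕ num 1
tailT (blk t u) = u
tailT (hls t u m) = u

isHls : SpAtom → Set
isHls (hls _ _ _) = ⊤
isHls _ = ⊥

D : SpAtom → SpAtom → QF
D aᵢ aⱼ = (tailT aⱼ ≤q headT aᵢ) ∨q (tailT aᵢ ≤q headT aⱼ)

N : SpAtom → QF
N a = headT a <q tailT a

pairCond : SpAtom → SpAtom → QF
pairCond aᵢ@(hls _ _ _) aⱼ@(hls _ _ _) = (N aᵢ ∧q N aⱼ) ⇒q D aᵢ aⱼ
pairCond aᵢ@(hls _ _ _) aⱼ = N aᵢ ⇒q D aᵢ aⱼ
pairCond aᵢ aⱼ@(hls _ _ _) = N aⱼ ⇒q D aᵢ aⱼ
pairCond aᵢ aⱼ = D aᵢ aⱼ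

conjMap : (SpAtom → QF) → List SpAtom → QF
conjMap f [] = qtrue
conjMap f (a ∷ as) = f a ∧q conjMap f as

phiStarL : List SpAtom → QF
phiStarL [] = qtrue
phiStarL (a ∷ as) = conjMap (pairCond a) as ∧q phiStarL as

Abs : Formula → QF
Abs φ = pureQF (Formula.pure φ)
        ∧q (conjMap absAtom (atoms (Formula.spatial φ))
        ∧q phiStarL (atoms (Formula.spatial φ)))

-- Under a fixed stack the heap of each spatial atom covers exactly the interval [head, tail).
-- A heap list from a to b is a chain of chunks a ↦ d ∗ blk(a+1, a+d) with 2 ≤ d ≤ bound, so
-- a + 2 ≤ b when it is nonempty, and a ≡ b mod 2 when the bound is 2 (every chunk then has size 2).
-- Disjointness of ∗ keeps the nonempty intervals apart, which is φ_∗. Conversely, a model of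
-- Abs(φ) yields a heap for each atom inside its interval (heap lists are built from chunks of
-- size 2, plus one chunk of size 3 when the length is odd and the bound exceeds 2), and φ_∗ keeps
-- these intervals disjoint, so the heaps combine by ∗.

module Submission where

open import Defs
open import Data.Empty using (⊥-elim)
open import Data.List using (List; []; _∷_)
open import Data.List.Relation.Unary.All as All using (All; []; _∷_)
open import Data.List.Relation.Unary.All.Properties using (All¬⇒¬Any)
open import Data.List.Relation.Unary.Any using (Any; here; there)
open import Data.Maybe using (Maybe; just; nothing; _<∣>_)
open import Data.Nat using (ℕ; zero; suc; _+_; _∸_; _≤_; _<_; _%_; _≟_; _≤?_; _<?_; z≤n; s≤s)
open import Data.Nat.DivMod using ([m+n]%n≡m%n)
open import Data.Nat.Properties
open import Data.Product using (Σ; ∃; _×_; _,_; proj₁; proj₂; map₁; map₂)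
open import Data.Sum using (_⊎_; inj₁; inj₂)
open import Data.Unit using (tt)
open import Function using (id; _∘_)
open import Function.Bundles using (_⇔_; mk⇔)
open import Level using (0ℓ)
open import Relation.Nullary using (yes; no)
open import Relation.Nullary.Decidable using (_×-dec_)
open import Relation.Unary using (Pred; Decidable; _⊆_; _⊥_)
open import Relation.Binary.PropositionalEquality

[_,_⟩ : ℕ → ℕ → Pred ℕ 0ℓ
[ a , b ⟩ x = a ≤ x × x < b

[_,_⟩? : ∀ a b → Decidable [ a , b ⟩
[ a , b ⟩? x = a ≤? x ×-dec x <? b

∈[n,n+1⟩⇒≡n : ∀ {n x} → [ n , n + 1 ⟩ x → x ≡ n
∈[n,n+1⟩⇒≡n {n} {x} (n≤x , x<n+1) = ≤-antisym (m<1+n⇒m≤n (subst (x <_) (+-comm n 1) x<n+1)) n≤x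

Separated : ℕ → ℕ → ℕ → ℕ → Set
Separated a b c d = d ≤ a ⊎ b ≤ c

separated⇒⊥ : ∀ {a b c d} → Separated a b c d → [ a , b ⟩ ⊥ [ c , d ⟩
separated⇒⊥ (inj₁ d≤a) ((a≤x , _) , (_ , x<d)) = <⇒≱ x<d (≤-trans d≤a a≤x)
separated⇒⊥ (inj₂ b≤c) ((_ , x<b) , (c≤x , _)) = <⇒≱ x<b (≤-trans b≤c c≤x)

⊥⇒separated : ∀ {a b c d} → a < b → c < d → [ a , b ⟩ ⊥ [ c , d ⟩ → Separated a b c d
⊥⇒separated {a} {b} {c} {d} a<b c<d apart with d ≤? a | b ≤? c | ≤-total a c
... | yes d≤a | _       | _        = inj₁ d≤a
... | no _    | yes b≤c | _        = inj₂ b≤c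
... | no _    | no b≰c  | inj₁ a≤c = ⊥-elim (apart ((a≤c , ≰⇒> b≰c) , (≤-refl , c<d)))
... | no d≰a  | no _    | inj₂ c≤a = ⊥-elim (apart ((≤-refl , a<b) , (c≤a , ≰⇒> d≰a)))

chunk-end : ∀ a z → 2 ≤ z ∸ a → a + (z ∸ a) ≡ z
chunk-end a z 2≤z∸a = m+[n∸m]≡n (<⇒≤ (m∸n≢0⇒n<m {z} {a} (m<n⇒n≢0 2≤z∸a)))

chunk-≤ : ∀ a z → 2 ≤ z ∸ a → a + 2 ≤ z
chunk-≤ a z 2≤z∸a = subst (a + 2 ≤_) (chunk-end a z 2≤z∸a) (+-monoʳ-≤ a 2≤z∸a)

+2≤⇒2≤∸ : ∀ {a b} → a + 2 ≤ b → 2 ≤ b ∸ a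
+2≤⇒2≤∸ {a} {b} a+2≤b = m+n≤o⇒m≤o∸n 2 (subst (_≤ b) (+-comm a 2) a+2≤b)

[1+n]%2≡1⇒n%2≡0 : ∀ n → suc n % 2 ≡ 1 → n % 2 ≡ 0
[1+n]%2≡1⇒n%2≡0 zero _ = refl
[1+n]%2≡1⇒n%2≡0 (suc zero) ()
[1+n]%2≡1⇒n%2≡0 (suc (suc n)) eq = [1+n]%2≡1⇒n%2≡0 n eq

m%2≡n%2⇒[n∸m]%2≡0 : ∀ {m n} → m ≤ n → m % 2 ≡ n % 2 → (n ∸ m) % 2 ≡ 0
m%2≡n%2⇒[n∸m]%2≡0 {zero} _ eq = sym eq
m%2≡n%2⇒[n∸m]%2≡0 {suc zero} (s≤s {n = n} _) eq = [1+n]%2≡1⇒n%2≡0 n (sym eq)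
m%2≡n%2⇒[n∸m]%2≡0 {suc (suc m)} (s≤s (s≤s m≤n)) eq = m%2≡n%2⇒[n∸m]%2≡0 m≤n eq

∅ₕ : Heap
∅ₕ _ = nothing

_∪ₕ_ : Heap → Heap → Heap
(h₁ ∪ₕ h₂) x = h₁ x <∣> h₂ x

fill : {P : Pred ℕ 0ℓ} → Decidable P → ℕ → Heap
fill P? v x with P? x
... | yes _ = just v
... | no _  = nothing

singleton : ℕ → ℕ → Heap
singleton a v = fill (_≟ a) v

block : ℕ → ℕ → Heap
block a b = fill [ a , b ⟩? 0

DomIs⇒⊆ : ∀ {h P} → DomIs h P → InDom h ⊆ P
DomIs⇒⊆ dom {x} = proj₁ (dom x)

DomIs⇒⊇ : ∀ {h P} → DomIs h P → P ⊆ InDom h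
DomIs⇒⊇ dom {x} = proj₂ (dom x)

∅ₕ-emp : EmpH ∅ₕ
∅ₕ-emp _ = (λ { (_ , ()) }) , λ ()

∪ₕ-split : ∀ {h₁ h₂} → InDom h₁ ⊥ InDom h₂ → Split (h₁ ∪ₕ h₂) h₁ h₂
∪ₕ-split {h₁} {h₂} apart x with h₁ x in eq₁ | h₂ x in eq₂
... | nothing | _       = inj₁ (refl , refl)
... | just _  | nothing = inj₂ (refl , refl)
... | just v  | just w  = ⊥-elim (apart ((v , eq₁) , (w , eq₂)))

∪ₕ-⊆ : ∀ {h₁ h₂} {P : Pred ℕ 0ℓ} → InDom h₁ ⊆ P → InDom h₂ ⊆ P → InDom (h₁ ∪ₕ h₂) ⊆ P
∪ₕ-⊆ {h₁} dom₁ dom₂ {x} (v , eq) with h₁ x in eq₁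
... | just w  = dom₁ (w , eq₁)
... | nothing = dom₂ (v , eq)

split-∅ₕˡ : ∀ {h} → Split h ∅ₕ h
split-∅ₕˡ _ = inj₁ (refl , refl)

split-domˡ : ∀ {h h₁ h₂} → Split h h₁ h₂ → InDom h₁ ⊆ InDom h
split-domˡ split {x} (v , eq) with split x
... | inj₁ (h₁x≡nothing , _) with () ← trans (sym eq) h₁x≡nothing
... | inj₂ (_ , hx≡h₁x)      = v , trans hx≡h₁x eq

split-domʳ : ∀ {h h₁ h₂} → Split h h₁ h₂ → InDom h₂ ⊆ InDom h
split-domʳ split {x} (v , eq) with split x
... | inj₁ (_ , hx≡h₂x)      = v , trans hx≡h₂x eq
... | inj₂ (h₂x≡nothing , _) with () ← trans (sym eq) h₂x≡nothing

split-disjoint : ∀ {h h₁ h₂} → Split h h₁ h₂ → InDom h₁ ⊥ InDom h₂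
split-disjoint split {x} ((_ , eq₁) , (_ , eq₂)) with split x
... | inj₁ (h₁x≡nothing , _) with () ← trans (sym eq₁) h₁x≡nothing
... | inj₂ (h₂x≡nothing , _) with () ← trans (sym eq₂) h₂x≡nothing

∪ₕ-adjacent : ∀ {a b c h₁ h₂} → a ≤ b → b ≤ c → InDom h₁ ⊆ [ a , b ⟩ → InDom h₂ ⊆ [ b , c ⟩ →
              Split (h₁ ∪ₕ h₂) h₁ h₂ × InDom (h₁ ∪ₕ h₂) ⊆ [ a , c ⟩
∪ₕ-adjacent {h₁ = h₁} a≤b b≤c dom₁ dom₂ =
  ∪ₕ-split (λ {x} (x∈₁ , x∈₂) → separated⇒⊥ (inj₂ ≤-refl) {x} (dom₁ x∈₁ , dom₂ x∈₂)) ,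
  ∪ₕ-⊆ {h₁} (map₂ (λ x<b → <-≤-trans x<b b≤c) ∘ dom₁) (map₁ (≤-trans a≤b) ∘ dom₂)

fill-dom : ∀ {P : Pred ℕ 0ℓ} {v} (P? : Decidable P) → DomIs (fill P? v) P
fill-dom P? x with P? x
... | yes p  = (λ _ → p) , (λ _ → _ , refl)
... | no ¬p  = (λ { (_ , ()) }) , (λ p → ⊥-elim (¬p p))

singleton-pto : ∀ {a v} → PtoH a v (singleton a v)
singleton-pto {a} = fill-dom (_≟ a) , at-a
  where
  at-a : singleton a _ a ≡ just _
  at-a with a ≟ a
  ... | yes _  = refl
  ... | no a≢a = ⊥-elim (a≢a refl)

singleton-⊆ : ∀ {a v} → InDom (singleton a v) ⊆ [ a , a + 1 ⟩
singleton-⊆ {a} x∈ with DomIs⇒⊆ (fill-dom (_≟ a)) x∈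
... | refl = ≤-refl , m<m+n a 0<1+n

block-blk : ∀ {a b} → a < b → BlkH a b (block a b)
block-blk {a} {b} a<b = a<b , fill-dom [ a , b ⟩?

block-⊆ : ∀ {a b} → InDom (block a b) ⊆ [ a , b ⟩
block-⊆ {a} {b} = DomIs⇒⊆ (fill-dom [ a , b ⟩?)

hls⇒≤ : ∀ k {a b m h} → HlsK k a b m h → a ≤ b
hls⇒≤ zero    (refl , _) = ≤-refl
hls⇒≤ (suc k) {a} (z , 2≤z∸a , _ , _ , _ , _ , _ , _ , _ , _ , _ , H) =
  ≤-trans (m+n≤o⇒m≤o a (chunk-≤ a z 2≤z∸a)) (hls⇒≤ k H)

hls-suc⇒+2≤ : ∀ k {a b m h} → HlsK (suc k) a b m h → a + 2 ≤ b
hls-suc⇒+2≤ k {a} (z , 2≤z∸a , _ , _ , _ , _ , _ , _ , _ , _ , _ , H) = ≤-trans (chunk-≤ a z 2≤z∸a) (hls⇒≤ k H)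

hls-covers : ∀ k {a b m h} → HlsK k a b m h → [ a , b ⟩ ⊆ InDom h
hls-covers zero (refl , _) (a≤x , x<a) = ⊥-elim (<⇒≱ x<a a≤x)
hls-covers (suc k) {a} (z , _ , _ , _ , _ , split , pto , _ , _ , split′ , (_ , block-dom) , H) {x} (a≤x , x<b)
  with x <? z | x ≟ a
... | no x≮z  | _        = split-domʳ split (split-domʳ split′ (hls-covers k H (≮⇒≥ x≮z , x<b)))
... | yes _   | yes refl = split-domˡ split (_ , proj₂ pto)
... | yes x<z | no x≢a   = split-domʳ split (split-domˡ split′ (DomIs⇒⊇ block-dom (a+1≤x , x<z)))
  where
  a+1≤x : a + 1 ≤ x
  a+1≤x = subst (_≤ x) (+-comm 1 a) (≤∧≢⇒< a≤x (≢-sym x≢a))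

hls-parity : ∀ k {a b v h} → v ≤ 2 → HlsK k a b (just v) h → a % 2 ≡ b % 2
hls-parity zero _ (refl , _) = refl
hls-parity (suc k) {a} {b} v≤2 (z , 2≤z∸a , z∸a≤v , _ , _ , _ , _ , _ , _ , _ , _ , H) = begin
  a % 2              ≡⟨ [m+n]%n≡m%n a 2 ⟨
  (a + 2) % 2        ≡⟨ cong (λ d → (a + d) % 2) z∸a≡2 ⟨
  (a + (z ∸ a)) % 2  ≡⟨ cong (_% 2) (chunk-end a z 2≤z∸a) ⟩
  z % 2              ≡⟨ hls-parity k v≤2 H ⟩
  b % 2              ∎
  where
  open ≡-Reasoning
  z∸a≡2 : z ∸ a ≡ 2
  z∸a≡2 = ≤-antisym (≤-trans z∸a≤v v≤2) 2≤z∸a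

Aplusᵛ : ℕ → ℕ → Maybe ℕ → Set
Aplusᵛ a b nothing  = a + 2 ≤ b
Aplusᵛ a b (just v) = (v ≡ 2 × (a + 2 ≤ b × a % 2 ≡ b % 2)) ⊎ (2 < v × a + 2 ≤ b)

-- Once m is a constructor, s ⊨q absAtom (hls t u m) unfolds to HlsShape (⟦ t ⟧ s) (⟦ u ⟧ s) (evalInf m s).
HlsShape : ℕ → ℕ → Maybe ℕ → Set
HlsShape a b m = a ≡ b ⊎ (a < b × Aplusᵛ a b m)

hls-suc⇒Aplusᵛ : ∀ k {a b m h} → HlsK (suc k) a b m h → Aplusᵛ a b m
hls-suc⇒Aplusᵛ k {m = nothing} H = hls-suc⇒+2≤ k H
hls-suc⇒Aplusᵛ k {m = just v} H@(_ , 2≤d , d≤v , _) with 2 <? v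
... | yes 2<v = inj₂ (2<v , hls-suc⇒+2≤ k H)
... | no 2≮v  = inj₁ (≤-antisym v≤2 (≤-trans 2≤d d≤v) , hls-suc⇒+2≤ k H , hls-parity (suc k) v≤2 H)
  where
  v≤2 = ≮⇒≥ 2≮v

hls⇒shape : ∀ k {a b m h} → HlsK k a b m h → HlsShape a b m
hls⇒shape zero    (a≡b , _) = inj₁ a≡b
hls⇒shape (suc k) H = inj₂ (<-≤-trans (m<m+n _ 0<1+n) (hls-suc⇒+2≤ k H) , hls-suc⇒Aplusᵛ k H)

HlsHeap : ℕ → ℕ → Maybe ℕ → Set
HlsHeap a b m = Σ Heap λ h → (∃ λ k → HlsK k a b m h) × InDom h ⊆ [ a , b ⟩

hls-nil : ∀ {a m} → HlsHeap a a m
hls-nil = ∅ₕ , (0 , refl , ∅ₕ-emp) , λ { (_ , ()) }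

hls-cons : ∀ {a d b m} → 2 ≤ d → boundOK d m → HlsHeap (a + d) b m → HlsHeap a b m
hls-cons {a} {d} {b} {m} 2≤d d≤m (h₃ , (k , H) , dom₃) =
  h₁ ∪ₕ h′ ,
  (suc k , z , 2≤z∸a , z∸a≤m , h₁ , h′ , proj₁ cell+rest , singleton-pto ,
           h₂ , h₃ , proj₁ block+rest , block-blk a+1<z , H) ,
  proj₂ cell+rest
  where
  z = a + d
  z∸a≡d : z ∸ a ≡ d
  z∸a≡d = m+n∸m≡n a d
  2≤z∸a : 2 ≤ z ∸ a
  2≤z∸a = subst (2 ≤_) (sym z∸a≡d) 2≤d
  z∸a≤m : boundOK (z ∸ a) m
  z∸a≤m = subst (λ e → boundOK e m) (sym z∸a≡d) d≤m
  a+1<z : a + 1 < z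
  a+1<z = +-monoʳ-< a 2≤d
  h₁ = singleton a (z ∸ a)
  h₂ = block (a + 1) z
  h′ = h₂ ∪ₕ h₃
  block+rest : Split h′ h₂ h₃ × InDom h′ ⊆ [ a + 1 , b ⟩
  block+rest = ∪ₕ-adjacent (<⇒≤ a+1<z) (hls⇒≤ k H) block-⊆ dom₃
  cell+rest : Split (h₁ ∪ₕ h′) h₁ h′ × InDom (h₁ ∪ₕ h′) ⊆ [ a , b ⟩
  cell+rest = ∪ₕ-adjacent (m≤m+n a 1) (≤-trans (<⇒≤ a+1<z) (hls⇒≤ k H)) singleton-⊆ (proj₂ block+rest)

hls-2-chunks : ∀ {m} a n → boundOK 2 m → n % 2 ≡ 0 → HlsHeap a (a + n) m
hls-2-chunks {m} a zero _ _ = subst (λ b → HlsHeap a b m) (sym (+-identityʳ a)) hls-nil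
hls-2-chunks {m} a (suc (suc n)) 2≤m even =
  hls-cons ≤-refl 2≤m (subst (λ b → HlsHeap (a + 2) b m) (+-assoc a 2 n) (hls-2-chunks (a + 2) n 2≤m even))

hls-2-3-chunks : ∀ {m} a n → boundOK 2 m → boundOK 3 m → 2 ≤ n → HlsHeap a (a + n) m
hls-2-3-chunks a 1 _ _ (s≤s ())
hls-2-3-chunks a 2 2≤m _ _ = hls-cons ≤-refl 2≤m hls-nil
hls-2-3-chunks a 3 _ 3≤m _ = hls-cons (s≤s (s≤s z≤n)) 3≤m hls-nil
hls-2-3-chunks {m} a (suc (suc n@(suc (suc _)))) 2≤m 3≤m _ =
  hls-cons ≤-refl 2≤m (subst (λ b → HlsHeap (a + 2) b m) (+-assoc a 2 n)
    (hls-2-3-chunks (a + 2) n 2≤m 3≤m (s≤s (s≤s z≤n))))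

hls-span : ∀ {a b m} → a ≤ b → HlsHeap a (a + (b ∸ a)) m → HlsHeap a b m
hls-span {a} {m = m} a≤b = subst (λ c → HlsHeap a c m) (m+[n∸m]≡n a≤b)

shape⇒hls : ∀ {a b} m → HlsShape a b m → HlsHeap a b m
shape⇒hls m (inj₁ refl) = hls-nil
shape⇒hls nothing (inj₂ (a<b , a+2≤b)) =
  hls-span (<⇒≤ a<b) (hls-2-3-chunks _ _ tt tt (+2≤⇒2≤∸ a+2≤b))
shape⇒hls (just v) (inj₂ (a<b , inj₁ (refl , _ , a≡b[2]))) =
  hls-span (<⇒≤ a<b) (hls-2-chunks _ _ ≤-refl (m%2≡n%2⇒[n∸m]%2≡0 (<⇒≤ a<b) a≡b[2]))
shape⇒hls (just v) (inj₂ (a<b , inj₂ (2<v , a+2≤b))) =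
  hls-span (<⇒≤ a<b) (hls-2-3-chunks _ _ (<⇒≤ 2<v) 2<v (+2≤⇒2≤∸ a+2≤b))

⊨ₚₐ≡pureAtomQF : ∀ s a → (s ⊨ₚₐ a) ≡ (s ⊨q pureAtomQF a)
⊨ₚₐ≡pureAtomQF s ptop     = refl
⊨ₚₐ≡pureAtomQF s pbot     = refl
⊨ₚₐ≡pureAtomQF s (_ =ₚ _) = refl
⊨ₚₐ≡pureAtomQF s (_ ≠ₚ _) = refl
⊨ₚₐ≡pureAtomQF s (_ ≤ₚ _) = refl
⊨ₚₐ≡pureAtomQF s (_ <ₚ _) = refl

⊨ₚ≡pureQF : ∀ s Π → (s ⊨ₚ Π) ≡ (s ⊨q pureQF Π)
⊨ₚ≡pureQF s []      = refl
⊨ₚ≡pureQF s (a ∷ Π) = cong₂ _×_ (⊨ₚₐ≡pureAtomQF s a) (⊨ₚ≡pureQF s Π)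

conjMap⁺ : ∀ {s f} as → All (λ a → s ⊨q f a) as → s ⊨q conjMap f as
conjMap⁺ []       []       = tt
conjMap⁺ (_ ∷ as) (p ∷ ps) = p , conjMap⁺ as ps

conjMap⁻ : ∀ {s f} as → s ⊨q conjMap f as → All (λ a → s ⊨q f a) as
conjMap⁻ []       _        = []
conjMap⁻ (_ ∷ as) (p , ps) = p ∷ conjMap⁻ as ps

-- φ_Σ ∧ φ_∗, so that Abs (∃[ zs ]· Π ∶ S) is pureQF Π ∧q AbsΣ S by definition.
AbsΣ : Spatial → QF
AbsΣ S = conjMap absAtom (atoms S) ∧q phiStarL (atoms S)

module _ (s : Stack) where

  ⟪_⟫ : SpAtom → Pred ℕ 0ℓ
  ⟪ a ⟫ = [ ⟦ headT a ⟧ s , ⟦ tailT a ⟧ s ⟩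

  ⋃⟪_⟫ : List SpAtom → Pred ℕ 0ℓ
  ⋃⟪ as ⟫ x = Any (λ a → ⟪ a ⟫ x) as

  ↦-N : ∀ t u → s ⊨q N (t ↦ u)
  ↦-N t _ = m<m+n (⟦ t ⟧ s) 0<1+n

  -- emp has the empty interval [0, 0⟩, so D holds trivially for it.
  pairCond-intro : ∀ a b → s ⊨q absAtom a → s ⊨q absAtom b →
                   (s ⊨q N a → s ⊨q N b → s ⊨q D a b) → s ⊨q pairCond a b
  pairCond-intro (hls _ _ _) (hls _ _ _) _  _  sep (Na , Nb) = sep Na Nb
  pairCond-intro (hls _ _ _) emp         _  _  _   _  = inj₁ z≤n
  pairCond-intro (hls _ _ _) (t ↦ u)     _  _  sep Na = sep Na (↦-N t u)
  pairCond-intro (hls _ _ _) (blk _ _)   _  Nb sep Na = sep Na Nb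
  pairCond-intro emp         (hls _ _ _) _  _  _   _  = inj₂ z≤n
  pairCond-intro (t ↦ u)     (hls _ _ _) _  _  sep Nb = sep (↦-N t u) Nb
  pairCond-intro (blk _ _)   (hls _ _ _) Na _  sep Nb = sep Na Nb
  pairCond-intro emp         emp         _  _  _   = inj₂ z≤n
  pairCond-intro emp         (_ ↦ _)     _  _  _   = inj₂ z≤n
  pairCond-intro emp         (blk _ _)   _  _  _   = inj₂ z≤n
  pairCond-intro (_ ↦ _)     emp         _  _  _   = inj₁ z≤n
  pairCond-intro (blk _ _)   emp         _  _  _   = inj₁ z≤n
  pairCond-intro (t ↦ u)     (t′ ↦ u′)   _  _  sep = sep (↦-N t u) (↦-N t′ u′)
  pairCond-intro (t ↦ u)     (blk _ _)   _  Nb sep = sep (↦-N t u) Nb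
  pairCond-intro (blk _ _)   (t′ ↦ u′)   Na _  sep = sep Na (↦-N t′ u′)
  pairCond-intro (blk _ _)   (blk _ _)   Na Nb sep = sep Na Nb

  pairCond-elim : ∀ a b → s ⊨q pairCond a b → s ⊨q N a → s ⊨q N b → s ⊨q D a b
  pairCond-elim (hls _ _ _) (hls _ _ _) pc Na Nb = pc (Na , Nb)
  pairCond-elim (hls _ _ _) emp         pc Na _  = pc Na
  pairCond-elim (hls _ _ _) (_ ↦ _)     pc Na _  = pc Na
  pairCond-elim (hls _ _ _) (blk _ _)   pc Na _  = pc Na
  pairCond-elim emp         (hls _ _ _) pc _  Nb = pc Nb
  pairCond-elim (_ ↦ _)     (hls _ _ _) pc _  Nb = pc Nb
  pairCond-elim (blk _ _)   (hls _ _ _) pc _  Nb = pc Nb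
  pairCond-elim emp         emp         pc _  _  = pc
  pairCond-elim emp         (_ ↦ _)     pc _  _  = pc
  pairCond-elim emp         (blk _ _)   pc _  _  = pc
  pairCond-elim (_ ↦ _)     emp         pc _  _  = pc
  pairCond-elim (blk _ _)   emp         pc _  _  = pc
  pairCond-elim (_ ↦ _)     (_ ↦ _)     pc _  _  = pc
  pairCond-elim (_ ↦ _)     (blk _ _)   pc _  _  = pc
  pairCond-elim (blk _ _)   (_ ↦ _)     pc _  _  = pc
  pairCond-elim (blk _ _)   (blk _ _)   pc _  _  = pc

  Placed : Heap → SpAtom → Set
  Placed h a = ⟪ a ⟫ ⊆ InDom h × s ⊨q absAtom a

  placed-⊆ : ∀ {h₁ h a} → InDom h₁ ⊆ InDom h → Placed h₁ a → Placed h a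
  placed-⊆ h₁⊆h (covered , abs) = (λ x∈ → h₁⊆h (covered x∈)) , abs

  ⊨ₐ⇒placed : ∀ a {h} → s , h ⊨ₐ a → Placed h a
  ⊨ₐ⇒placed emp                _           = (λ { (_ , ()) }) , tt
  ⊨ₐ⇒placed (t ↦ u)            (dom , _)   = (λ x∈ → DomIs⇒⊇ dom (∈[n,n+1⟩⇒≡n x∈)) , tt
  ⊨ₐ⇒placed (blk t u)          (t<u , dom) = DomIs⇒⊇ dom , t<u
  ⊨ₐ⇒placed (hls t u nothing)  (k , H)     = hls-covers k H , hls⇒shape k H
  ⊨ₐ⇒placed (hls t u (just _)) (k , H)     = hls-covers k H , hls⇒shape k H

  placed-pairCond : ∀ a {b h₁ h₂} → InDom h₁ ⊥ InDom h₂ → Placed h₁ a → Placed h₂ b → s ⊨q pairCond a b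
  placed-pairCond a {b} h₁⊥h₂ (covered-a , abs-a) (covered-b , abs-b) =
    pairCond-intro a b abs-a abs-b λ Na Nb →
      ⊥⇒separated Na Nb λ (x∈a , x∈b) → h₁⊥h₂ (covered-a x∈a , covered-b x∈b)

  placed-∷ : ∀ a as {h h₁ h₂} → Split h h₁ h₂ → s , h₁ ⊨ₐ a →
             All (Placed h₂) as × s ⊨q phiStarL as → All (Placed h) (a ∷ as) × s ⊨q phiStarL (a ∷ as)
  placed-∷ a as split ⊨a (placed , ⋆) =
    placed-⊆ (split-domˡ split) placed-a ∷ All.map (placed-⊆ (split-domʳ split)) placed ,
    conjMap⁺ as (All.map (placed-pairCond a (split-disjoint split) placed-a) placed) , ⋆
    where
    placed-a = ⊨ₐ⇒placed a ⊨a

  ⊨ₛ⇒placed : ∀ S {h} → s , h ⊨ₛ S → All (Placed h) (atoms S) × s ⊨q phiStarL (atoms S)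
  ⊨ₛ⇒placed []                  _                         = [] , tt
  ⊨ₛ⇒placed (emp ∷ S)           (_ , _ , split , _ , ⊨S)  =
    map₁ (All.map (placed-⊆ (split-domʳ split))) (⊨ₛ⇒placed S ⊨S)
  ⊨ₛ⇒placed (a@(_ ↦ _) ∷ S)     (_ , _ , split , ⊨a , ⊨S) = placed-∷ a (atoms S) split ⊨a (⊨ₛ⇒placed S ⊨S)
  ⊨ₛ⇒placed (a@(blk _ _) ∷ S)   (_ , _ , split , ⊨a , ⊨S) = placed-∷ a (atoms S) split ⊨a (⊨ₛ⇒placed S ⊨S)
  ⊨ₛ⇒placed (a@(hls _ _ _) ∷ S) (_ , _ , split , ⊨a , ⊨S) = placed-∷ a (atoms S) split ⊨a (⊨ₛ⇒placed S ⊨S)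

  ⊨ₛ⇒AbsΣ : ∀ S {h} → s , h ⊨ₛ S → s ⊨q AbsΣ S
  ⊨ₛ⇒AbsΣ S ⊨S = let placed , ⋆ = ⊨ₛ⇒placed S ⊨S in conjMap⁺ (atoms S) (All.map proj₂ placed) , ⋆

  atom-model : ∀ a → s ⊨q absAtom a → Σ Heap λ h → s , h ⊨ₐ a × InDom h ⊆ ⟪ a ⟫
  atom-model emp                _     = ∅ₕ , ∅ₕ-emp , λ { (_ , ()) }
  atom-model (t ↦ u)            _     = singleton _ _ , singleton-pto , singleton-⊆
  atom-model (blk t u)          t<u   = block _ _ , block-blk t<u , block-⊆
  atom-model (hls t u nothing)  shape = shape⇒hls nothing shape
  atom-model (hls t u (just _)) shape = shape⇒hls (just _) shape

  pairCond⇒⊥ : ∀ a b → s ⊨q pairCond a b → ⟪ a ⟫ ⊥ ⟪ b ⟫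
  pairCond⇒⊥ a b pc {x} (x∈a@(ha≤x , x<ta) , x∈b@(hb≤x , x<tb)) =
    separated⇒⊥ (pairCond-elim a b pc (≤-<-trans ha≤x x<ta) (≤-<-trans hb≤x x<tb)) {x} (x∈a , x∈b)

  model-∷ : ∀ a as {S} → s ⊨q absAtom a → s ⊨q conjMap (pairCond a) as →
            (Σ Heap λ h → s , h ⊨ₛ S × InDom h ⊆ ⋃⟪ as ⟫) →
            Σ Heap λ h → s , h ⊨ₛ (a ∷ S) × InDom h ⊆ ⋃⟪ a ∷ as ⟫
  model-∷ a as abs-a pcs (h₂ , ⊨S , dom₂) with atom-model a abs-a
  ... | h₁ , ⊨a , dom₁ =
    h₁ ∪ₕ h₂ , (h₁ , h₂ , ∪ₕ-split apart , ⊨a , ⊨S) , ∪ₕ-⊆ {h₁} (here ∘ dom₁) (there ∘ dom₂)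
    where
    apart : InDom h₁ ⊥ InDom h₂
    apart (x∈₁ , x∈₂) =
      All¬⇒¬Any (All.map (λ {b} pc x∈b → pairCond⇒⊥ a b pc (dom₁ x∈₁ , x∈b)) (conjMap⁻ as pcs)) (dom₂ x∈₂)

  AbsΣ⇒⊨ₛ : ∀ S → s ⊨q AbsΣ S → Σ Heap λ h → s , h ⊨ₛ S × InDom h ⊆ ⋃⟪ atoms S ⟫
  AbsΣ⇒⊨ₛ []                  _ = ∅ₕ , ∅ₕ-emp , λ { (_ , ()) }
  AbsΣ⇒⊨ₛ (emp ∷ S)           abs with AbsΣ⇒⊨ₛ S abs
  ... | h , ⊨S , dom = h , (∅ₕ , h , split-∅ₕˡ , ∅ₕ-emp , ⊨S) , dom
  AbsΣ⇒⊨ₛ (a@(_ ↦ _) ∷ S)     ((abs-a , abs) , pcs , ⋆) = model-∷ a (atoms S) abs-a pcs (AbsΣ⇒⊨ₛ S (abs , ⋆))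
  AbsΣ⇒⊨ₛ (a@(blk _ _) ∷ S)   ((abs-a , abs) , pcs , ⋆) = model-∷ a (atoms S) abs-a pcs (AbsΣ⇒⊨ₛ S (abs , ⋆))
  AbsΣ⇒⊨ₛ (a@(hls _ _ _) ∷ S) ((abs-a , abs) , pcs , ⋆) = model-∷ a (atoms S) abs-a pcs (AbsΣ⇒⊨ₛ S (abs , ⋆))

module _ {s s′ : Stack} (s≗s′ : s ≗ s′) where

  ⟦⟧-cong : ∀ t → ⟦ t ⟧ s ≡ ⟦ t ⟧ s′
  ⟦⟧-cong (var x) = s≗s′ x
  ⟦⟧-cong (num n) = refl
  ⟦⟧-cong (t ⊕ u) = cong₂ _+_ (⟦⟧-cong t) (⟦⟧-cong u)

  evalInf-cong : ∀ m → evalInf m s ≡ evalInf m s′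
  evalInf-cong nothing  = refl
  evalInf-cong (just t) = cong just (⟦⟧-cong t)

  ⊨ₚₐ-resp : ∀ a → s ⊨ₚₐ a → s′ ⊨ₚₐ a
  ⊨ₚₐ-resp ptop     p = p
  ⊨ₚₐ-resp pbot     ()
  ⊨ₚₐ-resp (t =ₚ u) p = subst₂ _≡_ (⟦⟧-cong t) (⟦⟧-cong u) p
  ⊨ₚₐ-resp (t ≠ₚ u) p = subst₂ _≢_ (⟦⟧-cong t) (⟦⟧-cong u) p
  ⊨ₚₐ-resp (t ≤ₚ u) p = subst₂ _≤_ (⟦⟧-cong t) (⟦⟧-cong u) p
  ⊨ₚₐ-resp (t <ₚ u) p = subst₂ _<_ (⟦⟧-cong t) (⟦⟧-cong u) p

  ⊨ₚ-resp : ∀ Π → s ⊨ₚ Π → s′ ⊨ₚ Π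
  ⊨ₚ-resp []      _        = tt
  ⊨ₚ-resp (a ∷ Π) (p , ps) = ⊨ₚₐ-resp a p , ⊨ₚ-resp Π ps

  ⊨ₐ-resp : ∀ a {h} → s , h ⊨ₐ a → s′ , h ⊨ₐ a
  ⊨ₐ-resp emp           p = p
  ⊨ₐ-resp (t ↦ u)   {h} p = subst₂ (λ a v → PtoH a v h) (⟦⟧-cong t) (⟦⟧-cong u) p
  ⊨ₐ-resp (blk t u) {h} p = subst₂ (λ a b → BlkH a b h) (⟦⟧-cong t) (⟦⟧-cong u) p
  ⊨ₐ-resp (hls t u m) (k , H)
    rewrite ⟦⟧-cong t | ⟦⟧-cong u | evalInf-cong m = k , H

  ⊨ₛ-resp : ∀ S {h} → s , h ⊨ₛ S → s′ , h ⊨ₛ S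
  ⊨ₛ-resp []      p                          = p
  ⊨ₛ-resp (a ∷ S) (h₁ , h₂ , split , ⊨a , ⊨S) = h₁ , h₂ , split , ⊨ₐ-resp a ⊨a , ⊨ₛ-resp S ⊨S

update-self : ∀ s z → s ≗ update s z (s z)
update-self s z y with y ≟ z
... | yes refl = refl
... | no _     = refl

Models-intro : ∀ zs {s h Π S} → s ⊨ₚ Π → s , h ⊨ₛ S → Models s h zs Π S
Models-intro []       ⊨Π ⊨S = ⊨Π , ⊨S
Models-intro (z ∷ zs) {s} {Π = Π} {S} ⊨Π ⊨S =
  s z , Models-intro zs (⊨ₚ-resp (update-self s z) Π ⊨Π) (⊨ₛ-resp (update-self s z) S ⊨S)

Models-elim : ∀ zs {s h Π S} → Models s h zs Π S → Σ Stack λ s′ → s′ ⊨ₚ Π × s′ , h ⊨ₛ S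
Models-elim []       {s} (⊨Π , ⊨S) = s , ⊨Π , ⊨S
Models-elim (_ ∷ zs) (_ , ⊨φ)      = Models-elim zs ⊨φ

proposition1 : (φ : Formula) → Satisfiable φ ⇔ QFSatisfiable (Abs φ)
proposition1 (∃[ zs ]· Π ∶ S) = mk⇔ sound complete
  where
  sound : Satisfiable (∃[ zs ]· Π ∶ S) → QFSatisfiable (pureQF Π ∧q AbsΣ S)
  sound (_ , h , ⊨φ) =
    let s , ⊨Π , ⊨S = Models-elim zs ⊨φ
    in  s , subst id (⊨ₚ≡pureQF s Π) ⊨Π , ⊨ₛ⇒AbsΣ s S ⊨S
  complete : QFSatisfiable (pureQF Π ∧q AbsΣ S) → Satisfiable (∃[ zs ]· Π ∶ S)
  complete (s , ⊨pureQF , ⊨AbsΣ) =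
    let h , ⊨S , _ = AbsΣ⇒⊨ₛ s S ⊨AbsΣ
    in  s , h , Models-intro zs (subst id (sym (⊨ₚ≡pureQF s Π)) ⊨pureQF) ⊨S
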